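{- Let $\mathcal{M},s$ and $\mathcal{M}',s'$ be pointed dependence epistemic models (over the same $\mathbb{P},\mathbb{V}$). Let $\mathcal{D}$ be either $\mathcal{D}_g$ (with $\mathfrak{G}=\mathfrak{G}_g$) or $\mathcal{D}_l$ (with $\mathfrak{G}=\mathfrak{G}_l$). Then $\mathcal{M},s$ and $\mathcal{M}',s'$ satisfy exactly the same formulas $\mathcal{D}(X,Y)$ for all finite $X,Y\subseteq\mathbb{V}$ if and only if $\mathfrak{G}(s)=\mathfrak{G}(s')$.
   Context: Fix a countable set $\mathbb{P}$ of propositions and a countable set $\mathbb{V}$ of variables. A dependence epistemic model is $\mathcal{M}=\langle S,T,V,U,\sim_i,\approx\rangle$ where $S$ is a set of worlds, $T:S\times\mathbb{P}\to\{0,1\}$, $V\supseteq\mathbb{V}$ is a countable set of variables, $U:S\times V\to\mathbb{N}$, and $\sim_i,\approx$ are equivalence relations on $S$. For $s,t\in S$ and $X\subseteq V$, write $X_s=X_t$ iff $U(s,x)=U(t,x)$ for all $x\in X$, and $X_s\neq X_t$ otherwise. Semantics (for finite $X,Y\subseteq\mathbb{V}$): $\mathcal{M},s\vDash\mathcal{D}_g(X,Y)$ iff there exist $u,v\in S$ with $u\approx v\approx s$, $(V\setminus(X\cup Y))_u=(V\setminus(X\cup Y))_v$, $X_u\neq X_v$ and $Y_u\neq Y_v$; $\mathcal{M},s\vDash\mathcal{D}_l(X,Y)$ iff there exists $t\in S$ with $t\approx s$, $(V\setminus(X\cup Y))_t=(V\setminus(X\cup Y))_s$, $X_t\neq X_s$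 and $Y_t\neq Y_s$. For $u,v\in S$, $\Delta(u,v)=\{x\in\mathbb{V}\mid U(u,x)\neq U(v,x)\}$ if $(V\setminus\mathbb{V})_u=(V\setminus\mathbb{V})_v$, and $\Delta(u,v)=\emptyset$ otherwise. $W$ is an evidence of $\langle X,Y\rangle$ iff $W\cap X\neq\emptyset$, $W\cap Y\neq\emptyset$, $W\subseteq X\cup Y$. $\mathcal{P}_g(s)=\{\Delta(u,v)\mid u,v\in S,\ u\approx v\approx s,\ \Delta(u,v)\text{ nonempty finite}\}$ and $\mathcal{P}_l(s)=\{\Delta(t,s)\mid t\in S,\ t\approx s,\ \Delta(t,s)\text{ nonempty finite}\}$. A nonempty finite $W\subseteq\mathbb{V}$ is generative from $\mathcal{P}(s)$ iff for all finite $X,Y\subseteq\mathbb{V}$ such that $W$ is an evidence of $\langle X,Y\rangle$, there is $W'\in\mathcal{P}(s)$ that is also an evidence of $\langle X,Y\rangle$. $\mathfrak{G}_g(s)$ (resp. $\mathfrak{G}_l(s)$) is the set of all nonempty finite $W\subseteq\mathbb{V}$ generative from $\mathcal{P}_g(s)$ (resp. $\mathcal{P}_l(s)$). -}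

module Defs where

open import Data.Nat using (ℕ)
open import Data.Bool using (Bool)
open import Data.List using (List)
open import Data.List.Membership.Propositional using (_∈_)
open import Data.Product using (Σ; _×_; ∃; ∃-syntax)
open import Data.Sum using (_⊎_; inj₁; inj₂)
open import Relation.Nullary using (¬_)
open import Relation.Binary.PropositionalEquality using (_≡_; _≢_)
open import Relation.Binary.Structures using (IsEquivalence)
open import Function.Definitions using (Injective)
open import Function.Bundles using (_⇔_)

Countable : Set → Set
Countable A = Σ (A → ℕ) (Injective _≡_ _≡_)

-- Dependence epistemic models over propositions ℙ, variables 𝕍, agents Ag.
-- The variable set V ⊇ 𝕍 is represented as 𝕍 ⊎ Extra, so that V ∖ 𝕍 = Extra.
record DEModel (ℙ 𝕍 Ag : Set) : Set₁ where
  field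
    S        : Set
    T        : S → ℙ → Bool
    Extra    : Set
    Extra-countable : Countable Extra
    U        : S → (𝕍 ⊎ Extra) → ℕ
    _∼[_]_   : S → Ag → S → Set
    ∼-equiv  : (i : Ag) → IsEquivalence (λ s t → s ∼[ i ] t)
    _≈_      : S → S → Set
    ≈-equiv  : IsEquivalence _≈_

module _ {ℙ 𝕍 Ag : Set} (M : DEModel ℙ 𝕍 Ag) where
  open DEModel M

  -- Finite subsets of 𝕍 are given by lists (membership = list membership).
  _∪_ : List 𝕍 → List 𝕍 → 𝕍 → Set
  (X ∪ Y) x = x ∈ X ⊎ x ∈ Y

  AgreeOff : List 𝕍 → List 𝕍 → S → S → Set
  AgreeOff X Y u v =
    ((x : 𝕍) → ¬ (X ∪ Y) x → U u (inj₁ x) ≡ U v (inj₁ x)) ×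
    ((e : Extra) → U u (inj₂ e) ≡ U v (inj₂ e))

  AgreeOn : List 𝕍 → S → S → Set
  AgreeOn X u v = (x : 𝕍) → x ∈ X → U u (inj₁ x) ≡ U v (inj₁ x)

  SatDg : S → List 𝕍 → List 𝕍 → Set
  SatDg s X Y = ∃[ u ] ∃[ v ] (u ≈ v × v ≈ s × AgreeOff X Y u v ×
                 ¬ AgreeOn X u v × ¬ AgreeOn Y u v)

  SatDl : S → List 𝕍 → List 𝕍 → Set
  SatDl s X Y = ∃[ t ] (t ≈ s × AgreeOff X Y t s ×
                 ¬ AgreeOn X t s × ¬ AgreeOn Y t s)

  Δ : S → S → 𝕍 → Set
  Δ u v x = ((e : Extra) → U u (inj₂ e) ≡ U v (inj₂ e)) × U u (inj₁ x) ≢ U v (inj₁ x)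

module _ {𝕍 : Set} where
  NonEmpty : (𝕍 → Set) → Set
  NonEmpty A = ∃[ x ] A x

  Finite : (𝕍 → Set) → Set
  Finite A = ∃[ xs ] ((x : 𝕍) → A x ⇔ x ∈ xs)

  IsEvidence : (𝕍 → Set) → List 𝕍 → List 𝕍 → Set
  IsEvidence W X Y = (∃[ x ] (W x × x ∈ X)) × (∃[ y ] (W y × y ∈ Y)) ×
                     ((z : 𝕍) → W z → z ∈ X ⊎ z ∈ Y)

module _ {ℙ 𝕍 Ag : Set} (M : DEModel ℙ 𝕍 Ag) where
  open DEModel M

  EvidenceInPg : S → List 𝕍 → List 𝕍 → Set
  EvidenceInPg s X Y = ∃[ u ] ∃[ v ] (u ≈ v × v ≈ s ×
    NonEmpty (Δ M u v) × Finite (Δ M u v) × IsEvidence (Δ M u v) X Y)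

  EvidenceInPl : S → List 𝕍 → List 𝕍 → Set
  EvidenceInPl s X Y = ∃[ t ] (t ≈ s ×
    NonEmpty (Δ M t s) × Finite (Δ M t s) × IsEvidence (Δ M t s) X Y)

data Mode : Set where
  global local : Mode

module _ {ℙ 𝕍 Ag : Set} (M : DEModel ℙ 𝕍 Ag) where
  open DEModel M

  Sat : Mode → S → List 𝕍 → List 𝕍 → Set
  Sat global = SatDg M
  Sat local  = SatDl M

  EvidenceInP : Mode → S → List 𝕍 → List 𝕍 → Set
  EvidenceInP global = EvidenceInPg M
  EvidenceInP local  = EvidenceInPl M

  InG : Mode → S → List 𝕍 → Set
  InG m s W = NonEmpty (λ x → x ∈ W) ×
    ((X Y : List 𝕍) → IsEvidence (λ x → x ∈ W) X Y → EvidenceInP m s X Y)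

-- A formula D(X,Y) holds at s exactly when some member W of P(s) is an evidence of ⟨X,Y⟩:
-- the two points witnessing D(X,Y) differ on a nonempty finite set of variables meeting both
-- X and Y and contained in X ∪ Y, and conversely. Such a W is itself generative, since every
-- pair it is an evidence of is witnessed by W itself. Hence the pairs witnessed by P(s) are
-- exactly the pairs witnessed by 𝔊(s), so each of the two families determines the other.
module Submission where

open import Defs
open import Data.Nat as ℕ using ()
open import Data.List using (List; _++_; filter)
open import Data.List.Membership.Propositional using (_∈_; find)
open import Data.List.Membership.Propositional.Properties
  using (∈-++⁺ˡ; ∈-++⁺ʳ; ∈-filter⁺; ∈-filter⁻)
import Data.List.Membership.DecPropositional as DecMembership
import Data.List.Relation.Unary.All as All
open import Data.List.Relation.Unary.All.Properties using (¬All⇒Any¬)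
open import Data.Product using (_×_; _,_; ∃-syntax; proj₂)
open import Data.Sum using (_⊎_; inj₁; inj₂; [_,_])
open import Function.Base using (_∘_)
open import Function.Bundles using (_⇔_; mk⇔; mk↣; Equivalence)
open import Function.Construct.Composition using (_⇔-∘_)
open import Function.Construct.Symmetry using (⇔-sym)
open import Relation.Nullary using (¬_; yes; no; contradiction)
open import Relation.Nullary.Decidable using (via-injection; ¬?; decidable-stable)
open import Relation.Binary.PropositionalEquality using (_≡_; _≢_)
open import Relation.Binary.Definitions using (DecidableEquality)

open Equivalence

Countable⇒DecidableEquality : {A : Set} → Countable A → DecidableEquality A
Countable⇒DecidableEquality (f , f-injective) = via-injection (mk↣ f-injective) ℕ._≟_

∀₂-⇔-cong : {I J : Set} {A B A′ B′ : I → J → Set} →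
  (∀ i j → A i j ⇔ B i j) → (∀ i j → A′ i j ⇔ B′ i j) →
  (∀ i j → A i j ⇔ A′ i j) ⇔ (∀ i j → B i j ⇔ B′ i j)
∀₂-⇔-cong A⇔B A′⇔B′ = mk⇔
  (λ A⇔A′ i j → A′⇔B′ i j ⇔-∘ (A⇔A′ i j ⇔-∘ ⇔-sym (A⇔B i j)))
  (λ B⇔B′ i j → ⇔-sym (A′⇔B′ i j) ⇔-∘ (B⇔B′ i j ⇔-∘ A⇔B i j))

module _ {𝕍 : Set} where

  IsEvidence-resp-⇔ : {A B : 𝕍 → Set} → (∀ x → A x ⇔ B x) →
    ∀ {X Y} → IsEvidence A X Y → IsEvidence B X Y
  IsEvidence-resp-⇔ A⇔B ((x , ax , x∈X) , (y , ay , y∈Y) , A⊆X∪Y) =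
    (x , to (A⇔B x) ax , x∈X) , (y , to (A⇔B y) ay , y∈Y) ,
    λ z bz → A⊆X∪Y z (from (A⇔B z) bz)

  -- For E = EvidenceInP M m s this is InG M m s.
  Generative : (List 𝕍 → List 𝕍 → Set) → List 𝕍 → Set
  Generative E W = NonEmpty (_∈ W) × (∀ X Y → IsEvidence (_∈ W) X Y → E X Y)

  Generated : (List 𝕍 → List 𝕍 → Set) → Set
  Generated E = ∀ X Y → E X Y → ∃[ W ] (Generative E W × IsEvidence (_∈ W) X Y)

  Generative-mono : {E E′ : List 𝕍 → List 𝕍 → Set} → (∀ X Y → E X Y → E′ X Y) →
    ∀ {W} → Generative E W → Generative E′ W
  Generative-mono E⇒E′ (nonempty , generative) =
    nonempty , λ X Y ev → E⇒E′ X Y (generative X Y ev)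

  Generative⊆⇒⊆ : {E E′ : List 𝕍 → List 𝕍 → Set} → Generated E →
    (∀ W → Generative E W → Generative E′ W) → ∀ X Y → E X Y → E′ X Y
  Generative⊆⇒⊆ generated G⊆G′ X Y e =
    let W , W-generative , W-evidence = generated X Y e
    in proj₂ (G⊆G′ W W-generative) X Y W-evidence

  pointwise⇔⇔Generative⇔ : {E E′ : List 𝕍 → List 𝕍 → Set} → Generated E → Generated E′ →
    (∀ X Y → E X Y ⇔ E′ X Y) ⇔ (∀ W → Generative E W ⇔ Generative E′ W)
  pointwise⇔⇔Generative⇔ generated generated′ = mk⇔
    (λ E⇔E′ W → mk⇔ (Generative-mono (λ X Y → to (E⇔E′ X Y)))
                    (Generative-mono (λ X Y → from (E⇔E′ X Y))))
    (λ G⇔G′ X Y → mk⇔ (Generative⊆⇒⊆ generated (λ W → to (G⇔G′ W)) X Y)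
                      (Generative⊆⇒⊆ generated′ (λ W → from (G⇔G′ W)) X Y))

  finite-evidence-generative : {A : 𝕍 → Set} {E : List 𝕍 → List 𝕍 → Set} →
    (∀ X Y → IsEvidence A X Y → E X Y) → NonEmpty A → Finite A →
    ∀ {X Y} → IsEvidence A X Y → ∃[ W ] (Generative E W × IsEvidence (_∈ W) X Y)
  finite-evidence-generative A-evidence⇒E (x , ax) (W , A⇔W) ev =
    W , ((x , to (A⇔W x) ax) ,
         λ X Y → A-evidence⇒E X Y ∘ IsEvidence-resp-⇔ (⇔-sym ∘ A⇔W)) ,
    IsEvidence-resp-⇔ A⇔W ev

module _ {ℙ 𝕍 Ag : Set} (_≟_ : DecidableEquality 𝕍) (M : DEModel ℙ 𝕍 Ag) where
  open DEModel M
  open DecMembership _≟_ using (_∈?_)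

  module _ (u v : S) where

    AgreeOnExtra : Set
    AgreeOnExtra = (e : Extra) → U u (inj₂ e) ≡ U v (inj₂ e)

    Differ : 𝕍 → Set
    Differ x = U u (inj₁ x) ≢ U v (inj₁ x)

    Dependence : List 𝕍 → List 𝕍 → Set
    Dependence X Y = AgreeOff M X Y u v × ¬ AgreeOn M X u v × ¬ AgreeOn M Y u v

    ¬AgreeOn⇒∃Differ : ∀ {X} → ¬ AgreeOn M X u v → ∃[ x ] (x ∈ X × Differ x)
    ¬AgreeOn⇒∃Differ {X} ¬agree = find (¬All⇒Any¬ (λ x → U u (inj₁ x) ℕ.≟ U v (inj₁ x)) X
      (λ agree → ¬agree (λ _ x∈X → All.lookup agree x∈X)))

    AgreeOff⇒Differ⊆X∪Y : ∀ {X Y} → AgreeOff M X Y u v → ∀ x → Differ x → x ∈ X ⊎ x ∈ Y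
    AgreeOff⇒Differ⊆X∪Y {X} {Y} (agree , _) x differ with x ∈? X | x ∈? Y
    ... | yes x∈X | _       = inj₁ x∈X
    ... | no _    | yes x∈Y = inj₂ x∈Y
    ... | no x∉X  | no x∉Y  = contradiction (agree x [ x∉X , x∉Y ]) differ

    Differ⊆X∪Y⇒AgreeOff : ∀ {X Y} → (∀ x → Differ x → x ∈ X ⊎ x ∈ Y) →
      AgreeOnExtra → AgreeOff M X Y u v
    Differ⊆X∪Y⇒AgreeOff Differ⊆X∪Y extra =
      (λ x x∉X∪Y → decidable-stable (U u (inj₁ x) ℕ.≟ U v (inj₁ x)) (x∉X∪Y ∘ Differ⊆X∪Y x)) ,
      extra

    Δ-finite : AgreeOnExtra → ∀ L → (∀ x → Differ x → x ∈ L) → Finite (Δ M u v)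
    Δ-finite extra L Differ⊆L = filter differ? L , λ x → mk⇔
      (λ (_ , differ) → ∈-filter⁺ differ? (Differ⊆L x differ) differ)
      (λ x∈filter → extra , proj₂ (∈-filter⁻ differ? {xs = L} x∈filter))
      where
        differ? = λ x → ¬? (U u (inj₁ x) ℕ.≟ U v (inj₁ x))

    Dependence⇔Δ-evidence : ∀ X Y → Dependence X Y ⇔
      (NonEmpty (Δ M u v) × Finite (Δ M u v) × IsEvidence (Δ M u v) X Y)
    Dependence⇔Δ-evidence X Y = mk⇔ dependence⇒evidence evidence⇒dependence
      where
        dependence⇒evidence : Dependence X Y →
          NonEmpty (Δ M u v) × Finite (Δ M u v) × IsEvidence (Δ M u v) X Y
        dependence⇒evidence (off@(_ , extra) , ¬onX , ¬onY) =
          let x , x∈X , differ-x = ¬AgreeOn⇒∃Differ ¬onX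
              y , y∈Y , differ-y = ¬AgreeOn⇒∃Differ ¬onY
              Differ⊆X∪Y = AgreeOff⇒Differ⊆X∪Y off
          in (x , extra , differ-x) ,
             Δ-finite extra (X ++ Y) (λ z → [ ∈-++⁺ˡ , ∈-++⁺ʳ X ] ∘ Differ⊆X∪Y z) ,
             (x , (extra , differ-x) , x∈X) , (y , (extra , differ-y) , y∈Y) ,
             λ z → Differ⊆X∪Y z ∘ proj₂

        evidence⇒dependence : NonEmpty (Δ M u v) × Finite (Δ M u v) ×
          IsEvidence (Δ M u v) X Y → Dependence X Y
        evidence⇒dependence ((_ , extra , _) , _ ,
                             (x , (_ , differ-x) , x∈X) , (y , (_ , differ-y) , y∈Y) , Δ⊆X∪Y) =
          Differ⊆X∪Y⇒AgreeOff (λ z → Δ⊆X∪Y z ∘ (extra ,_)) extra ,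
          (λ onX → differ-x (onX x x∈X)) , (λ onY → differ-y (onY y y∈Y))

  Sat⇔EvidenceInP : ∀ m s X Y → Sat M m s X Y ⇔ EvidenceInP M m s X Y
  Sat⇔EvidenceInP global s X Y = mk⇔
    (λ (u , v , u≈v , v≈s , dep) → u , v , u≈v , v≈s , to (Dependence⇔Δ-evidence u v X Y) dep)
    (λ (u , v , u≈v , v≈s , ev) → u , v , u≈v , v≈s , from (Dependence⇔Δ-evidence u v X Y) ev)
  Sat⇔EvidenceInP local s X Y = mk⇔
    (λ (t , t≈s , dep) → t , t≈s , to (Dependence⇔Δ-evidence t s X Y) dep)
    (λ (t , t≈s , ev) → t , t≈s , from (Dependence⇔Δ-evidence t s X Y) ev)

  EvidenceInP-generated : ∀ m s → Generated (EvidenceInP M m s)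
  EvidenceInP-generated global s X Y (u , v , u≈v , v≈s , nonempty , finite , ev) =
    finite-evidence-generative (λ _ _ ev′ → u , v , u≈v , v≈s , nonempty , finite , ev′)
      nonempty finite ev
  EvidenceInP-generated local s X Y (t , t≈s , nonempty , finite , ev) =
    finite-evidence-generative (λ _ _ ev′ → t , t≈s , nonempty , finite , ev′)
      nonempty finite ev

mainTheorem4 : {ℙ 𝕍 Ag : Set} → Countable ℙ → Countable 𝕍 →
    (M : DEModel ℙ 𝕍 Ag) (s : DEModel.S M) →
    (M′ : DEModel ℙ 𝕍 Ag) (s′ : DEModel.S M′) →
    (m : Mode) →
    (((X Y : List 𝕍) → Sat M m s X Y ⇔ Sat M′ m s′ X Y) ⇔
     ((W : List 𝕍) → InG M m s W ⇔ InG M′ m s′ W))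
mainTheorem4 _ 𝕍-countable M s M′ s′ m =
  pointwise⇔⇔Generative⇔ (EvidenceInP-generated _≟_ M m s) (EvidenceInP-generated _≟_ M′ m s′)
  ⇔-∘ ∀₂-⇔-cong (Sat⇔EvidenceInP _≟_ M m s) (Sat⇔EvidenceInP _≟_ M′ m s′)
  where
    _≟_ = Countable⇒DecidableEquality 𝕍-countable
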